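{- Let $G$ be a $2$-connected cubic planar graph and let $(G',r)$ be the instance constructed from $G$ as described in the context. Then $\kappa(G',r)=\tau(G)+|E(G)|$, where $\tau(G)$ is the minimum size of a vertex cover of $G$.
   Context: All graphs are finite, simple and undirected. For a graph $H=(V,E)$ and $r:V\to\mathbb{Z}_+$, a vector connectivity set for $(H,r)$ is a set $S\subseteq V$ such that every $v\in V\setminus S$ is joined to $S$ by $r(v)$ paths that are pairwise vertex-disjoint except at $v$; $\kappa(H,r)$ denotes the minimum size of a vector connectivity set for $(H,r)$. A vertex cover is a vertex set meeting every edge. Construction of $G'$ from a cubic graph $G$: (1) replace each edge $e=xy$ of $G$ by a path $x,w_{x,e},w_e,w_{y,e},y$ on three new vertices; (2) for each edge $e=xy$ add two new vertices $z_{x,e},z_{y,e}$ with edges $w_{x,e}z_{x,e}$, $z_{x,e}w_e$, $w_ez_{y,e}$, $z_{y,e}w_{y,e}$ (so $z_{x,e}$ is the tip of a triangle on $w_{x,e}w_e$ and $z_{y,e}$ the tip of a triangle on $w_ew_{y,e}$); (3) for each vertex $x$ of $G$ with incident edges $e,f,g$, add the edges $w_{x,e}w_{x,f}$, $w_{x,e}w_{x,g}$, $w_{x,f}w_{x,g}$. Requirements: for each edge $e=xy$ of $G$, $r(w_{x,e})=r(w_{y,e})=4$ and $r(w_e)=3$; all other vertices of $G'$ have requirement $0$. -}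

module Defs where

open import Data.Nat using (ℕ; zero; suc; _+_; _≤_; _<ᵇ_)
open import Data.Bool using (Bool; true; false; _∧_)
open import Data.Fin using (Fin; toℕ) renaming (_<_ to _<F_)
open import Data.List using (List; []; _∷_; _++_; length; filterᵇ; allFin; cartesianProduct; last)
open import Data.List.Membership.Propositional using (_∈_; _∉_)
open import Data.List.Relation.Unary.All using (All)
open import Data.List.Relation.Unary.Any using (Any)
open import Data.List.Relation.Unary.AllPairs using (AllPairs)
open import Data.List.Relation.Unary.Linked using (Linked)
open import Data.List.Relation.Unary.Unique.Propositional using (Unique)
open import Data.List.Relation.Binary.Disjoint.Propositional using (Disjoint)
open import Data.Maybe using (just)
open import Data.Product using (Σ; _×_; _,_; proj₁; proj₂)
open import Data.Sum using (_⊎_)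
open import Data.Empty using (⊥)
open import Relation.Nullary using (¬_)
open import Relation.Binary.PropositionalEquality using (_≡_; _≢_)
open import Data.Rational using (ℚ; 0ℚ; 1ℚ) renaming (_+_ to _+ℚ_; _*_ to _*ℚ_; _-_ to _-ℚ_; _≤_ to _≤ℚ_)

-- Generic (finite, simple) graphs on an arbitrary vertex type V with an
-- edge relation E; vertex sets are duplicate-free lists.

-- p is the tail of a path starting at v and ending in S:
-- v ∷ p is a path (consecutive vertices adjacent, all vertices distinct),
-- p is nonempty and its last vertex lies in S.
record PathToSet {V : Set} (E : V → V → Set) (S : List V) (v : V) (p : List V) : Set where
  field
    linked   : Linked E (v ∷ p)
    distinct : Unique (v ∷ p)
    endpt    : V
    isLast   : last p ≡ just endpt
    endInS   : endpt ∈ S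

-- S is a vector connectivity set for (H, r), H = (V, E): every v ∉ S is
-- joined to S by r(v) paths which are pairwise vertex-disjoint except at v.
IsVCSet : {V : Set} (E : V → V → Set) (r : V → ℕ) (S : List V) → Set
IsVCSet {V} E r S =
  ∀ v → v ∉ S →
    Σ (List (List V)) λ ps →
      length ps ≡ r v × All (PathToSet E S v) ps × AllPairs Disjoint ps

IsKappa : {V : Set} (E : V → V → Set) (r : V → ℕ) (k : ℕ) → Set
IsKappa {V} E r k =
  (Σ (List V) λ S → Unique S × IsVCSet E r S × length S ≡ k)
  × (∀ (S : List V) → Unique S → IsVCSet E r S → k ≤ length S)

record SimpleGraph : Set where
  field
    n          : ℕ
    adj        : Fin n → Fin n → Bool
    adj-sym    : ∀ x y → adj x y ≡ adj y x
    adj-irrefl : ∀ x → adj x x ≡ false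

module _ (G : SimpleGraph) where
  open SimpleGraph G

  Cubic : Set
  Cubic = ∀ x → length (filterᵇ (adj x) (allFin n)) ≡ 3

  numEdges : ℕ
  numEdges = length (filterᵇ (λ xy → adj (proj₁ xy) (proj₂ xy) ∧ (toℕ (proj₁ xy) <ᵇ toℕ (proj₂ xy)))
                             (cartesianProduct (allFin n) (allFin n)))

  IsVertexCover : List (Fin n) → Set
  IsVertexCover C = ∀ x y → adj x y ≡ true → x ∈ C ⊎ y ∈ C

  IsTau : ℕ → Set
  IsTau t = (Σ (List (Fin n)) λ C → Unique C × IsVertexCover C × length C ≡ t)
            × (∀ C → Unique C → IsVertexCover C → t ≤ length C)

  data ReachAvoiding (X : List (Fin n)) : Fin n → Fin n → Set where
    here : ∀ {x} → x ∉ X → ReachAvoiding X x x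
    step : ∀ {x y z} → x ∉ X → adj x y ≡ true → ReachAvoiding X y z → ReachAvoiding X x z

  ConnectedAvoiding : List (Fin n) → Set
  ConnectedAvoiding X = ∀ x y → x ∉ X → y ∉ X → ReachAvoiding X x y

  TwoConnected : Set
  TwoConnected = 2 Data.Nat.< n × ConnectedAvoiding [] × (∀ w → ConnectedAvoiding (w ∷ []))

-- Planarity (Diestel's definition: drawing with polygonal arcs),
-- with coordinates in ℚ².

Pt : Set
Pt = ℚ × ℚ

OnSeg : Pt → Pt → Pt → Set
OnSeg p a b = Σ ℚ λ t → 0ℚ ≤ℚ t × t ≤ℚ 1ℚ
  × proj₁ p ≡ proj₁ a +ℚ t *ℚ (proj₁ b -ℚ proj₁ a)
  × proj₂ p ≡ proj₂ a +ℚ t *ℚ (proj₂ b -ℚ proj₂ a)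

segs : List Pt → List (Pt × Pt)
segs (a ∷ b ∷ ps) = (a , b) ∷ segs (b ∷ ps)
segs _ = []

OnPoly : Pt → List Pt → Set
OnPoly p ps = Any (λ s → OnSeg p (proj₁ s) (proj₂ s)) (segs ps)

-- the polygonal line is simple (homeomorphic to [0,1]): two consecutive
-- segments meet only in their common corner, non-consecutive ones are disjoint
data SimplePoly : List Pt → Set where
  two  : ∀ a b → SimplePoly (a ∷ b ∷ [])
  cons : ∀ a b c ps →
    SimplePoly (b ∷ c ∷ ps) →
    (∀ p → OnSeg p a b → OnSeg p b c → p ≡ b) →
    (∀ p → OnSeg p a b → ¬ OnPoly p (c ∷ ps)) →
    SimplePoly (a ∷ b ∷ c ∷ ps)

module _ (G : SimpleGraph) where
  open SimpleGraph G

  record PlaneDrawing : Set where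
    field
      pos     : Fin n → Pt
      pos-inj : ∀ x y → pos x ≡ pos y → x ≡ y
      -- inner corners of the arc drawing the edge xy (x < y)
      mid     : (x y : Fin n) → .(adj x y ≡ true) → .(x <F y) → List Pt
    arc : (x y : Fin n) → .(adj x y ≡ true) → .(x <F y) → List Pt
    arc x y h l = pos x ∷ mid x y h l ++ pos y ∷ []
    field
      arc-simple : ∀ x y .(h : adj x y ≡ true) .(l : x <F y) → SimplePoly (arc x y h l)
      no-vertex  : ∀ x y .(h : adj x y ≡ true) .(l : x <F y) (z : Fin n) →
                   z ≢ x → z ≢ y → ¬ OnPoly (pos z) (arc x y h l)
      no-cross   : ∀ x y .(h : adj x y ≡ true) .(l : x <F y)
                     x' y' .(h' : adj x' y' ≡ true) .(l' : x' <F y') →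
                   ¬ (x ≡ x' × y ≡ y') →
                   ∀ p → OnPoly p (arc x y h l) → p ≢ pos x → p ≢ pos y →
                   ¬ OnPoly p (arc x' y' h' l')

  Planar : Set
  Planar = PlaneDrawing

module _ (G : SimpleGraph) where
  open SimpleGraph G

  data V' : Set where
    orig : Fin n → V'
    wN   : (x y : Fin n) → .(adj x y ≡ true) → V'               -- w_{x,xy}
    zN   : (x y : Fin n) → .(adj x y ≡ true) → V'               -- z_{x,xy}
    wM   : (x y : Fin n) → .(adj x y ≡ true) → .(x <F y) → V'  -- w_{xy}, x < y

  data Arc' : V' → V' → Set where
    -- path x, w_{x,e}, w_e, w_{y,e}, y for e = xy (x < y)
    a-xw  : ∀ x y .(h : adj x y ≡ true) → Arc' (orig x) (wN x y h)
    a-wm₁ : ∀ x y .(h : adj x y ≡ true) .(l : x <F y) → Arc' (wN x y h) (wM x y h l)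
    a-wm₂ : ∀ x y .(h : adj x y ≡ true) .(h' : adj y x ≡ true) .(l : x <F y) →
            Arc' (wN y x h') (wM x y h l)
    -- triangles with tips z_{x,e}, z_{y,e}
    a-wz  : ∀ x y .(h : adj x y ≡ true) → Arc' (wN x y h) (zN x y h)
    a-zm₁ : ∀ x y .(h : adj x y ≡ true) .(l : x <F y) → Arc' (zN x y h) (wM x y h l)
    a-zm₂ : ∀ x y .(h : adj x y ≡ true) .(h' : adj y x ≡ true) .(l : x <F y) →
            Arc' (zN y x h') (wM x y h l)
    -- triangle on w_{x,e}, w_{x,f}, w_{x,g}
    a-ww  : ∀ x y y' .(h : adj x y ≡ true) .(h' : adj x y' ≡ true) → y ≢ y' →
            Arc' (wN x y h) (wN x y' h')

  E' : V' → V' → Set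
  E' u v = Arc' u v ⊎ Arc' v u

  r' : V' → ℕ
  r' (orig _)       = 0
  r' (wN _ _ _)     = 4
  r' (zN _ _ _)     = 0
  r' (wM _ _ _ _)   = 3

-- Let S be a vector connectivity set. The vertex w_e of an edge e = xy has the
-- four neighbours w_{x,e}, w_{y,e}, z_{x,e}, z_{y,e}, and the only other neighbour of z_{x,e}
-- is w_{x,e}; so if none of w_e, z_{x,e}, z_{y,e} is in S, each of its three disjoint paths
-- to S passes through w_{x,e} or w_{y,e}, which is impossible. Likewise, if none of x, z_{x,e},
-- w_{x,e} is in S, each of the four disjoint paths from w_{x,e} leaves through one of the three
-- edges of G at x. Hence S contains the set X of its vertices of G, one gadget vertex for every
-- edge, and a second one for every edge with no endpoint in X; and X together with one endpoint
-- of each such edge is a vertex cover of G. So |S| ≥ τ(G) + |E(G)|.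
--
-- For a vertex cover C take C together with, for each edge e = xy, the tip lying
-- opposite an endpoint in C: z_{y,e} if x ∈ C, and z_{x,e} otherwise. The required paths are
-- then listed explicitly, using that every vertex of G has three neighbours.

module Submission where

open import Defs
open import Data.Bool using (Bool; true; T; _∧_)
open import Data.Bool.Properties using (T-≡; T-∧) renaming (_≟_ to _≟ᵇ_)
open import Data.Empty using (⊥-elim; ⊥-elim-irr)
open import Data.Fin using (Fin; toℕ) renaming (_<_ to _<ᶠ_)
open import Data.Fin.Properties using (<-cmp; <-asym; <-irrefl) renaming (_≟_ to _≟ᶠ_)
open import Data.List using (List; []; _∷_; _++_; length; map; filter; filterᵇ; allFin; cartesianProduct; deduplicate)
open import Data.List.Properties using (length-++; length-map; length-deduplicate)
open import Data.List.Membership.Propositional using (_∈_; _∉_)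
open import Data.List.Membership.Propositional.Properties
  using (∈-∃++; ∈-++⁻; ∈-++⁺ˡ; ∈-++⁺ʳ; ∈-map⁺; ∈-map⁻; ∈-filter⁺; ∈-filter⁻; ∈-allFin; ∈-cartesianProduct⁺; ∈-deduplicate⁺)
import Data.List.Membership.DecPropositional as DecMembership
open import Data.List.Relation.Unary.All as All using (All; []; _∷_)
import Data.List.Relation.Unary.All.Properties as All
open import Data.List.Relation.Unary.Any using (here; there)
open import Data.List.Relation.Unary.AllPairs using (AllPairs; []; _∷_)
open import Data.List.Relation.Unary.Linked using ([-]; _∷_)
open import Data.List.Relation.Unary.Unique.Propositional using (Unique)
import Data.List.Relation.Unary.Unique.Propositional.Properties as Unique
import Data.List.Relation.Unary.Unique.DecPropositional.Properties as DecUnique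
open import Data.List.Relation.Binary.Disjoint.Propositional using (Disjoint)
open import Data.List.Relation.Binary.Subset.Propositional using (_⊆_)
open import Data.Nat using (ℕ; suc; _+_; _≤_; z≤n; s≤s; _<ᵇ_)
import Data.Nat as ℕ
open import Data.Nat.Properties using (≤-trans; ≤-reflexive; +-suc; +-assoc; +-comm; +-monoˡ-≤; n≮n; <ᵇ⇒<; <⇒<ᵇ; module ≤-Reasoning)
open import Data.Product using (Σ; _×_; _,_; proj₁; proj₂)
open import Data.Product.Properties using (≡-dec)
open import Data.Sum using (_⊎_; inj₁; inj₂; swap)
open import Function using (_∘_)
open import Function.Bundles using (Equivalence)
open import Relation.Binary using (tri<; tri≈; tri>)
open import Relation.Binary.Definitions using (DecidableEquality)
open import Relation.Binary.PropositionalEquality using (_≡_; _≢_; refl; sym; trans; cong; cong₂; subst; ≢-sym)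
open import Relation.Nullary using (¬_; yes; no; ¬?; _×-dec_)
open import Relation.Nullary.Decidable using (T?; map′; recompute)
open import Relation.Unary using (Decidable)

module _ {A : Set} where

  Unique⇒length-≤ : ∀ {xs ys : List A} → Unique xs → xs ⊆ ys → length xs ≤ length ys
  Unique⇒length-≤ {[]} _ _ = z≤n
  Unique⇒length-≤ {x ∷ xs} {ys} (x∉xs ∷ xs!) xs⊆ys with ∈-∃++ (xs⊆ys (here refl))
  ... | ys₁ , ys₂ , refl = begin
      suc (length xs)                ≤⟨ s≤s (Unique⇒length-≤ xs! xs⊆ys₁++ys₂) ⟩
      suc (length (ys₁ ++ ys₂))      ≡⟨ cong suc (length-++ ys₁) ⟩
      suc (length ys₁ + length ys₂)  ≡⟨ +-suc (length ys₁) (length ys₂) ⟨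
      length ys₁ + length (x ∷ ys₂)  ≡⟨ length-++ ys₁ ⟨
      length (ys₁ ++ x ∷ ys₂)        ∎
    where
    open ≤-Reasoning
    xs⊆ys₁++ys₂ : xs ⊆ ys₁ ++ ys₂
    xs⊆ys₁++ys₂ z∈xs with ∈-++⁻ ys₁ (xs⊆ys (there z∈xs))
    ... | inj₁ z∈ys₁         = ∈-++⁺ˡ z∈ys₁
    ... | inj₂ (here refl)   = ⊥-elim (All.lookup x∉xs z∈xs refl)
    ... | inj₂ (there z∈ys₂) = ∈-++⁺ʳ ys₁ z∈ys₂

  All≢⇒Disjoint : ∀ {xs ys : List A} → All (λ x → All (x ≢_) ys) xs → Disjoint xs ys
  All≢⇒Disjoint xs≢ys (x∈xs , x∈ys) = All.lookup (All.lookup xs≢ys x∈xs) x∈ys refl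

  other-two : ∀ (xs : List A) {d} → length xs ≡ 3 → Unique xs → d ∈ xs →
              Σ A λ a → Σ A λ b → a ∈ xs × b ∈ xs × a ≢ d × b ≢ d × a ≢ b
  other-two (a ∷ b ∷ c ∷ []) _ ((a≢b ∷ a≢c ∷ []) ∷ (b≢c ∷ []) ∷ _) (here refl) =
    b , c , there (here refl) , there (there (here refl)) , ≢-sym a≢b , ≢-sym a≢c , b≢c
  other-two (a ∷ b ∷ c ∷ []) _ ((a≢b ∷ a≢c ∷ []) ∷ (b≢c ∷ []) ∷ _) (there (here refl)) =
    a , c , here refl , there (there (here refl)) , a≢b , ≢-sym b≢c , a≢c
  other-two (a ∷ b ∷ c ∷ []) _ ((a≢b ∷ a≢c ∷ []) ∷ (b≢c ∷ []) ∷ _) (there (there (here refl))) =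
    a , b , here refl , there (here refl) , a≢c , b≢c , a≢b

module _ {A K : Set} (R : K → A → Set) where

  Meets : List K → List A → Set
  Meets ks p = Σ K λ k → k ∈ ks × Σ A λ a → R k a × a ∈ p

  disjoint-meeting-length-≤ : (∀ {k a b} → R k a → R k b → a ≡ b) →
                              ∀ ks {ps} → AllPairs Disjoint ps → All (Meets ks) ps → length ps ≤ length ks
  disjoint-meeting-length-≤ R-functional ks disjoint meets =
    subst (_≤ length ks) (length-keys meets) (Unique⇒length-≤ (keys-unique disjoint meets) (keys⊆ks meets))
    where
    keys : ∀ {qs} → All (Meets ks) qs → List K
    keys []       = []
    keys (m ∷ ms) = proj₁ m ∷ keys ms

    length-keys : ∀ {qs} (ms : All (Meets ks) qs) → length (keys ms) ≡ length qs
    length-keys []       = refl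
    length-keys (_ ∷ ms) = cong suc (length-keys ms)

    keys⊆ks : ∀ {qs} (ms : All (Meets ks) qs) → keys ms ⊆ ks
    keys⊆ks (m ∷ _)  (here refl) = proj₁ (proj₂ m)
    keys⊆ks (_ ∷ ms) (there k∈)  = keys⊆ks ms k∈

    distinct-keys : ∀ {p q} → Disjoint p q → (m : Meets ks p) (m' : Meets ks q) → proj₁ m ≢ proj₁ m'
    distinct-keys p#q (_ , _ , a , Rka , a∈p) (_ , _ , b , Rkb , b∈q) refl =
      p#q (a∈p , subst (_∈ _) (R-functional Rkb Rka) b∈q)

    keys-unique : ∀ {qs} → AllPairs Disjoint qs → (ms : All (Meets ks) qs) → Unique (keys ms)
    keys-unique []                  []       = []
    keys-unique (p#qs ∷ disjoint') (m ∷ ms) = fresh p#qs ms ∷ keys-unique disjoint' ms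
      where
      fresh : ∀ {qs} → All (Disjoint _) qs → (ms' : All (Meets ks) qs) → All (proj₁ m ≢_) (keys ms')
      fresh []           []         = []
      fresh (p#q ∷ p#qs') (m' ∷ ms') = distinct-keys p#q m m' ∷ fresh p#qs' ms'

Fan : {V : Set} (E : V → V → Set) (S : List V) → V → ℕ → Set
Fan {V} E S v k = Σ (List (List V)) λ ps → length ps ≡ k × All (PathToSet E S v) ps × AllPairs Disjoint ps

module _ {V : Set} {E : V → V → Set} {S : List V} where

  ¬PathToSet-[] : ∀ {v} → ¬ PathToSet E S v []
  ¬PathToSet-[] pt with PathToSet.isLast pt
  ... | ()

  PathToSet-second : ∀ {v u p} → PathToSet E S v (u ∷ p) → u ∉ S → Σ V λ w → E u w × w ≢ v × w ∈ p
  PathToSet-second {p = []} pt u∉S with PathToSet.isLast pt | PathToSet.endInS pt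
  ... | refl | u∈S = ⊥-elim (u∉S u∈S)
  PathToSet-second {p = w ∷ _} pt _ with PathToSet.linked pt | PathToSet.distinct pt
  ... | _ ∷ (u~w ∷ _) | (_ ∷ v≢w ∷ _) ∷ _ = w , u~w , ≢-sym v≢w , here refl

  pathToSet-edge : ∀ {v u} → E v u → v ≢ u → u ∈ S → PathToSet E S v (u ∷ [])
  pathToSet-edge v~u v≢u u∈S = record
    { linked = v~u ∷ [-] ; distinct = (v≢u ∷ []) ∷ [] ∷ [] ; endpt = _ ; isLast = refl ; endInS = u∈S }

  pathToSet-∷ : ∀ {v u p} → E v u → All (v ≢_) (u ∷ p) → PathToSet E S u p → PathToSet E S v (u ∷ p)
  pathToSet-∷ {p = []}    _   _   pt = ⊥-elim (¬PathToSet-[] pt)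
  pathToSet-∷ {p = _ ∷ _} v~u v∉p pt = record
    { linked   = v~u ∷ PathToSet.linked pt
    ; distinct = v∉p ∷ PathToSet.distinct pt
    ; endpt    = PathToSet.endpt pt
    ; isLast   = PathToSet.isLast pt
    ; endInS   = PathToSet.endInS pt
    }

  fan-size-≤ : ∀ {K} (R : K → V → Set) → (∀ {k a b} → R k a → R k b → a ≡ b) → ∀ ks {v k} →
               Fan E S v k → (∀ {p} → PathToSet E S v p → Meets R ks p) → k ≤ length ks
  fan-size-≤ R R-functional ks (_ , refl , paths , disjoint) meets =
    disjoint-meeting-length-≤ R R-functional ks disjoint (All.map meets paths)

module Construction (G : SimpleGraph) where
  open SimpleGraph G

  V : Set
  V = V' G

  E : V → V → Set
  E = E' G

  adj-recompute : ∀ {x y} → .(adj x y ≡ true) → adj x y ≡ true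
  adj-recompute {x} {y} = recompute (adj x y ≟ᵇ true)

  adj⇒≢ : ∀ {x y} → adj x y ≡ true → x ≢ y
  adj⇒≢ {x} h refl with trans (sym h) (adj-irrefl x)
  ... | ()

  adj-flip : ∀ {x y} → adj x y ≡ true → adj y x ≡ true
  adj-flip {x} {y} h = trans (adj-sym y x) h

  orig-injective : ∀ {x y} → orig {G = G} x ≡ orig y → x ≡ y
  orig-injective refl = refl

  private
    code : V → ℕ × Fin n × Fin n
    code (orig x)     = 0 , x , x
    code (wN x y _)   = 1 , x , y
    code (zN x y _)   = 2 , x , y
    code (wM x y _ _) = 3 , x , y

    code-injective : ∀ {u v} → code u ≡ code v → u ≡ v
    code-injective {orig _}     {orig _}     refl = refl
    code-injective {wN _ _ _}   {wN _ _ _}   refl = refl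
    code-injective {zN _ _ _}   {zN _ _ _}   refl = refl
    code-injective {wM _ _ _ _} {wM _ _ _ _} refl = refl

  _≟_ : DecidableEquality V
  u ≟ v = map′ code-injective (cong code) (≡-dec ℕ._≟_ (≡-dec _≟ᶠ_ _≟ᶠ_) (code u) (code v))

  neighbours : Fin n → List (Fin n)
  neighbours c = filterᵇ (adj c) (allFin n)

  neighbours-unique : ∀ c → Unique (neighbours c)
  neighbours-unique c = Unique.filter⁺ (T? ∘ adj c) (Unique.allFin⁺ n)

  adj⇒∈neighbours : ∀ {c u} → adj c u ≡ true → u ∈ neighbours c
  adj⇒∈neighbours {c} {u} h = ∈-filter⁺ (T? ∘ adj c) (∈-allFin u) (Equivalence.from T-≡ h)

  ∈neighbours⇒adj : ∀ {c u} → u ∈ neighbours c → adj c u ≡ true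
  ∈neighbours⇒adj {c} u∈ = Equivalence.to T-≡ (proj₂ (∈-filter⁻ (T? ∘ adj c) {xs = allFin n} u∈))

  other-neighbours : Cubic G → ∀ {c d} → adj c d ≡ true →
                     Σ (Fin n) λ u₁ → Σ (Fin n) λ u₂ →
                     adj c u₁ ≡ true × adj c u₂ ≡ true × u₁ ≢ d × u₂ ≢ d × u₁ ≢ u₂
  other-neighbours cubic {c} h with other-two (neighbours c) (cubic c) (neighbours-unique c) (adj⇒∈neighbours h)
  ... | u₁ , u₂ , u₁∈ , u₂∈ , u₁≢d , u₂≢d , u₁≢u₂ =
    u₁ , u₂ , ∈neighbours⇒adj u₁∈ , ∈neighbours⇒adj u₂∈ , u₁≢d , u₂≢d , u₁≢u₂

  record Edge : Set where
    constructor edge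
    field
      src tgt   : Fin n
      .adjacent : adj src tgt ≡ true
      .ordered  : src <ᶠ tgt

  open Edge

  private
    isEdgePair : Fin n × Fin n → Bool
    isEdgePair (x , y) = adj x y ∧ (toℕ x <ᵇ toℕ y)

    edgePairs : List (Fin n × Fin n)
    edgePairs = filterᵇ isEdgePair (cartesianProduct (allFin n) (allFin n))

    IsEdgePair : Fin n × Fin n → Set
    IsEdgePair (x , y) = adj x y ≡ true × x <ᶠ y

    edgePairs-sound : All IsEdgePair edgePairs
    edgePairs-sound = All.map sound (All.all-filter (T? ∘ isEdgePair) (cartesianProduct (allFin n) (allFin n)))
      where
      sound : ∀ {xy} → T (isEdgePair xy) → IsEdgePair xy
      sound {x , y} t with Equivalence.to T-∧ t
      ... | adj-t , <-t = Equivalence.to T-≡ adj-t , <ᵇ⇒< _ _ <-t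

    toEdges : ∀ {ps} → All IsEdgePair ps → List Edge
    toEdges []                        = []
    toEdges {(x , y) ∷ _} ((h , l) ∷ hs) = edge x y h l ∷ toEdges hs

    endpoints : Edge → Fin n × Fin n
    endpoints e = src e , tgt e

    endpoints-toEdges : ∀ {ps} (hs : All IsEdgePair ps) → map endpoints (toEdges hs) ≡ ps
    endpoints-toEdges []       = refl
    endpoints-toEdges (_ ∷ hs) = cong (_ ∷_) (endpoints-toEdges hs)

    ∈-toEdges : ∀ {ps x y} (hs : All IsEdgePair ps) → (x , y) ∈ ps → ∀ .h .l → edge x y h l ∈ toEdges hs
    ∈-toEdges (_ ∷ _)  (here refl) _ _ = here refl
    ∈-toEdges (_ ∷ hs) (there xy∈) h l = there (∈-toEdges hs xy∈ h l)

  edges : List Edge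
  edges = toEdges edgePairs-sound

  length-edges : length edges ≡ numEdges G
  length-edges = trans (sym (length-map endpoints edges)) (cong length (endpoints-toEdges edgePairs-sound))

  edges-unique : Unique edges
  edges-unique = Unique.map⁻ (subst Unique (sym (endpoints-toEdges edgePairs-sound))
    (Unique.filter⁺ (T? ∘ isEdgePair) (Unique.cartesianProduct⁺ (Unique.allFin⁺ n) (Unique.allFin⁺ n))))

  edge∈edges : ∀ {x y} (h : adj x y ≡ true) (l : x <ᶠ y) → edge x y h l ∈ edges
  edge∈edges {x} {y} h l = ∈-toEdges edgePairs-sound
    (∈-filter⁺ (T? ∘ isEdgePair) (∈-cartesianProduct⁺ (∈-allFin x) (∈-allFin y))
      (Equivalence.from T-∧ (Equivalence.from T-≡ h , <⇒<ᵇ l))) h l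

  data InGadget : Edge → V → Set where
    gadget-w-src : ∀ {x y} .{h l}    → InGadget (edge x y h l) (wN x y h)
    gadget-w-tgt : ∀ {x y} .{h l h'} → InGadget (edge x y h l) (wN y x h')
    gadget-mid   : ∀ {x y} .{h l}    → InGadget (edge x y h l) (wM x y h l)
    gadget-z-src : ∀ {x y} .{h l}    → InGadget (edge x y h l) (zN x y h)
    gadget-z-tgt : ∀ {x y} .{h l h'} → InGadget (edge x y h l) (zN y x h')

  ¬InGadget-orig : ∀ {e x} → ¬ InGadget e (orig x)
  ¬InGadget-orig ()

  gadget-injective : ∀ {e e' v v'} → InGadget e v → InGadget e' v' → v ≡ v' → e ≡ e'
  gadget-injective gadget-w-src gadget-w-src refl = refl
  gadget-injective gadget-w-tgt gadget-w-tgt refl = refl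
  gadget-injective gadget-mid   gadget-mid   refl = refl
  gadget-injective gadget-z-src gadget-z-src refl = refl
  gadget-injective gadget-z-tgt gadget-z-tgt refl = refl
  gadget-injective (gadget-w-src {l = l}) (gadget-w-tgt {l = l'}) refl = ⊥-elim-irr (<-asym l l')
  gadget-injective (gadget-w-tgt {l = l}) (gadget-w-src {l = l'}) refl = ⊥-elim-irr (<-asym l l')
  gadget-injective (gadget-z-src {l = l}) (gadget-z-tgt {l = l'}) refl = ⊥-elim-irr (<-asym l l')
  gadget-injective (gadget-z-tgt {l = l}) (gadget-z-src {l = l'}) refl = ⊥-elim-irr (<-asym l l')

  -- MidOf c u is w_e and TipOf c u holds of the two tips z_{c,e}, z_{u,e}, for e = cu in
  -- either orientation.
  data MidOf (c u : Fin n) : V → Set where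
    mid< : ∀ .{h : adj c u ≡ true} .(l : c <ᶠ u) → MidOf c u (wM c u h l)
    mid> : ∀ .{h : adj u c ≡ true} .(l : u <ᶠ c) → MidOf c u (wM u c h l)

  data TipOf (c u : Fin n) : V → Set where
    tip-near : ∀ .{h : adj c u ≡ true} → TipOf c u (zN c u h)
    tip-far  : ∀ .{h : adj u c ≡ true} → TipOf c u (zN u c h)

  midOf : ∀ {c u} → adj c u ≡ true → Σ V (MidOf c u)
  midOf {c} {u} h with <-cmp c u
  ... | tri< l _ _   = _ , mid< {h = h} l
  ... | tri≈ _ c≡u _ = ⊥-elim (adj⇒≢ h c≡u)
  ... | tri> _ _ l   = _ , mid> {h = adj-flip h} l

  MidOf-sym : ∀ {c u m} → MidOf c u m → MidOf u c m
  MidOf-sym (mid< l) = mid> l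
  MidOf-sym (mid> l) = mid< l

  MidOf-functional : ∀ {c u m m'} → MidOf c u m → MidOf c u m' → m ≡ m'
  MidOf-functional (mid< _) (mid< _)  = refl
  MidOf-functional (mid> _) (mid> _)  = refl
  MidOf-functional (mid< l) (mid> l') = ⊥-elim-irr (<-asym l l')
  MidOf-functional (mid> l) (mid< l') = ⊥-elim-irr (<-asym l l')

  MidOf-injective : ∀ {c u u' m} → MidOf c u m → MidOf c u' m → u ≡ u'
  MidOf-injective (mid< _) (mid< _) = refl
  MidOf-injective (mid< _) (mid> _) = refl
  MidOf-injective (mid> _) (mid< _) = refl
  MidOf-injective (mid> _) (mid> _) = refl

  TipOf-injective : ∀ {c u u' z} → TipOf c u z → TipOf c u' z → u ≡ u'
  TipOf-injective tip-near tip-near = refl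
  TipOf-injective tip-near tip-far  = refl
  TipOf-injective tip-far  tip-near = refl
  TipOf-injective tip-far  tip-far  = refl

  w-mid : ∀ {c u m} .{h : adj c u ≡ true} → MidOf c u m → E (wN c u h) m
  w-mid {c} {u} {h = h} (mid< l)          = inj₁ (a-wm₁ c u h l)
  w-mid {c} {u} {h = h} (mid> {h = h'} l) = inj₁ (a-wm₂ u c h' h l)

  mid-tip : ∀ {c u m z} → MidOf c u m → TipOf c u z → E m z
  mid-tip {c} {u} (mid< {h = h} l) tip-near          = inj₂ (a-zm₁ c u h l)
  mid-tip {c} {u} (mid< {h = h} l) (tip-far {h = h'}) = inj₂ (a-zm₂ c u h h' l)
  mid-tip {c} {u} (mid> {h = h} l) (tip-near {h = h'}) = inj₂ (a-zm₂ u c h h' l)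
  mid-tip {c} {u} (mid> {h = h} l) tip-far           = inj₂ (a-zm₁ u c h l)

  -- The ways a path from w_{c,cd} can leave the triangle at c: keyed by the neighbour u of c
  -- whose edge it enters, through w_{c,cu} if u ≠ d and through w_{cd} if u = d.
  data Exit (c d : Fin n) : Fin n → V → Set where
    exit-w   : ∀ {u} .{h : adj c u ≡ true} → u ≢ d → Exit c d u (wN c u h)
    exit-mid : ∀ {m} → MidOf c d m → Exit c d d m

  Exit-functional : ∀ {c d u v v'} → Exit c d u v → Exit c d u v' → v ≡ v'
  Exit-functional (exit-w _)      (exit-w _)       = refl
  Exit-functional (exit-w u≢d)    (exit-mid _)     = ⊥-elim (u≢d refl)
  Exit-functional (exit-mid _)    (exit-w u≢d)     = ⊥-elim (u≢d refl)
  Exit-functional (exit-mid mo)   (exit-mid mo')   = MidOf-functional mo mo'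

  Exit-adj : ∀ {c d u v} → .(adj c d ≡ true) → Exit c d u v → adj c u ≡ true
  Exit-adj _ (exit-w {h = h} _) = adj-recompute h
  Exit-adj h (exit-mid _)       = adj-recompute h

  data Side (c d : Fin n) : V → Set where
    side-w : ∀ .{h} → Side c d (wN c d h)
    side-z : ∀ .{h} → Side c d (zN c d h)

  Side-src : ∀ {x y v} .{h l} → Side x y v → InGadget (edge x y h l) v
  Side-src side-w = gadget-w-src
  Side-src side-z = gadget-z-src

  Side-tgt : ∀ {x y v} .{h l} → Side y x v → InGadget (edge x y h l) v
  Side-tgt side-w = gadget-w-tgt
  Side-tgt side-z = gadget-z-tgt

  Side-antisym : ∀ {x y v} → Side x y v → Side y x v → x ≡ y
  Side-antisym side-w side-w = refl
  Side-antisym side-z side-z = refl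

  module LowerBound (cubic : Cubic G) (S : List V) (vc : IsVCSet E (r' G) S) where
    open DecMembership _≟_ using (_∈?_)

    meets-via-exit : ∀ {c d u v p} → .(adj c d ≡ true) → Exit c d u v → v ∈ p → Meets (Exit c d) (neighbours c) p
    meets-via-exit h x v∈p = _ , adj⇒∈neighbours (Exit-adj h x) , _ , x , v∈p

    exit-on-path : ∀ {c d} .{h : adj c d ≡ true} → orig c ∉ S → zN c d h ∉ S →
                   ∀ {p} → PathToSet E S (wN c d h) p → Meets (Exit c d) (neighbours c) p
    exit-on-path     _  _  {[]}    pt = ⊥-elim (¬PathToSet-[] pt)
    exit-on-path {c} {d} {h} c∉S z∉S {_ ∷ p} pt with PathToSet.linked pt
    ... | inj₁ (a-wm₁ _ _ _ l)     ∷ _ = meets-via-exit h (exit-mid (mid< l)) (here refl)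
    ... | inj₁ (a-wm₂ _ _ _ _ l)   ∷ _ = meets-via-exit h (exit-mid (mid> l)) (here refl)
    ... | inj₁ (a-ww _ _ _ _ _ ne) ∷ _ = meets-via-exit h (exit-w (≢-sym ne)) (here refl)
    ... | inj₂ (a-ww _ _ _ _ _ ne) ∷ _ = meets-via-exit h (exit-w ne) (here refl)
    ... | inj₁ (a-wz _ _ _)        ∷ _ with PathToSet-second pt z∉S
    ...   | _ , inj₁ (a-zm₁ _ _ _ l)   , _   , w∈p = meets-via-exit h (exit-mid (mid< l)) (there w∈p)
    ...   | _ , inj₁ (a-zm₂ _ _ _ _ l) , _   , w∈p = meets-via-exit h (exit-mid (mid> l)) (there w∈p)
    ...   | _ , inj₂ (a-wz _ _ _)      , w≢v , _   = ⊥-elim (w≢v refl)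
    exit-on-path {c} {d} {h} c∉S z∉S {_ ∷ p} pt | inj₂ (a-xw _ _ _) ∷ _ with PathToSet-second pt c∉S
    ... | _ , inj₁ (a-xw _ y _) , w≢v , w∈p with y ≟ᶠ d
    ...   | yes refl = ⊥-elim (w≢v refl)
    ...   | no y≢d   = meets-via-exit h (exit-w y≢d) (there w∈p)

    exit-on-mid-path : ∀ {x y} .{h : adj x y ≡ true} .{h' : adj y x ≡ true} .(l : x <ᶠ y) →
                       zN x y h ∉ S → zN y x h' ∉ S → ∀ {p} → PathToSet E S (wM x y h l) p →
                       Meets _≡_ (wN x y h ∷ wN y x h' ∷ []) p
    exit-on-mid-path _ _   _   {[]}    pt = ⊥-elim (¬PathToSet-[] pt)
    exit-on-mid-path l zx∉S zy∉S {_ ∷ p} pt with PathToSet.linked pt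
    ... | inj₁ () ∷ _
    ... | inj₂ (a-wm₁ _ _ _ _)   ∷ _ = _ , here refl , _ , refl , here refl
    ... | inj₂ (a-wm₂ _ _ _ _ _) ∷ _ = _ , there (here refl) , _ , refl , here refl
    ... | inj₂ (a-zm₁ _ _ _ _)   ∷ _ with PathToSet-second pt zx∉S
    ...   | _ , inj₁ (a-zm₁ _ _ _ _)    , w≢v , _   = ⊥-elim (w≢v refl)
    ...   | _ , inj₁ (a-zm₂ _ _ _ _ l') , _   , _   = ⊥-elim-irr (<-asym l l')
    ...   | _ , inj₂ (a-wz _ _ _)       , _   , w∈p = _ , here refl , _ , refl , there w∈p
    exit-on-mid-path l zx∉S zy∉S {_ ∷ p} pt | inj₂ (a-zm₂ _ _ _ _ _) ∷ _ with PathToSet-second pt zy∉S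
    ...   | _ , inj₁ (a-zm₁ _ _ _ l')   , _   , _   = ⊥-elim-irr (<-asym l l')
    ...   | _ , inj₁ (a-zm₂ _ _ _ _ _)  , w≢v , _   = ⊥-elim (w≢v refl)
    ...   | _ , inj₂ (a-wz _ _ _)       , _   , w∈p = _ , there (here refl) , _ , refl , there w∈p

    Witness : Edge → Set
    Witness e = Σ V λ v → InGadget e v × v ∈ S

    gadget-meets-S : ∀ e → Witness e
    gadget-meets-S (edge x y h l) with wM x y h l ∈? S | zN x y h ∈? S | zN y x (adj-flip h) ∈? S
    ... | yes w∈S | _        | _        = _ , gadget-mid   , w∈S
    ... | no _    | yes z∈S  | _        = _ , gadget-z-src , z∈S
    ... | no _    | no _     | yes z∈S  = _ , gadget-z-tgt , z∈S
    ... | no w∉S  | no zx∉S  | no zy∉S  = ⊥-elim (n≮n 2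
      (fan-size-≤ _≡_ (λ p q → trans (sym p) q) (wN x y h ∷ wN y x (adj-flip h) ∷ [])
        (vc (wM x y h l) w∉S) (exit-on-mid-path l zx∉S zy∉S)))

    side-meets-S : ∀ c d .(h : adj c d ≡ true) → orig c ∉ S → Σ V λ v → Side c d v × v ∈ S
    side-meets-S c d h c∉S with wN c d h ∈? S | zN c d h ∈? S
    ... | yes w∈S | _       = _ , side-w , w∈S
    ... | no _    | yes z∈S = _ , side-z , z∈S
    ... | no w∉S  | no z∉S  = ⊥-elim (n≮n 3 (subst (4 ≤_) (cubic c)
      (fan-size-≤ (Exit c d) Exit-functional (neighbours c) (vc (wN c d h) w∉S) (exit-on-path c∉S z∉S))))

    Uncovered : Edge → Set
    Uncovered e = orig (src e) ∉ S × orig (tgt e) ∉ S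

    uncovered? : Decidable Uncovered
    uncovered? e = ¬? (orig (src e) ∈? S) ×-dec ¬? (orig (tgt e) ∈? S)

    -- On an uncovered edge the two witnesses lie on opposite sides of it; on a covered edge
    -- witness-tgt just repeats witness-src, but it is only applied to uncovered edges.
    witness-src witness-tgt : ∀ e → Witness e
    witness-src e@(edge x y h l) with uncovered? e
    ... | yes (x∉S , _) = let (v , side , v∈S) = side-meets-S x y h x∉S in v , Side-src side , v∈S
    ... | no _          = gadget-meets-S e
    witness-tgt e@(edge x y h l) with uncovered? e
    ... | yes (_ , y∉S) = let (v , side , v∈S) = side-meets-S y x (adj-flip h) y∉S in v , Side-tgt side , v∈S
    ... | no _          = gadget-meets-S e

    witnesses-differ : ∀ e → Uncovered e → proj₁ (witness-src e) ≢ proj₁ (witness-tgt e)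
    witnesses-differ e@(edge x y h l) unc with uncovered? e
    ... | no ¬unc = ⊥-elim (¬unc unc)
    ... | yes (x∉S , y∉S) with side-meets-S x y h x∉S | side-meets-S y x (adj-flip h) y∉S
    ...   | _ , sv , _ | _ , sw , _ = λ { refl → ⊥-elim-irr (<-irrefl (Side-antisym sv sw) l) }

    witness-injective : (f : ∀ e → Witness e) → ∀ {e e'} → proj₁ (f e) ≡ proj₁ (f e') → e ≡ e'
    witness-injective f {e} {e'} = gadget-injective (proj₁ (proj₂ (f e))) (proj₁ (proj₂ (f e')))

    orig∉witnesses : (f : ∀ e → Witness e) → ∀ {x} es → orig x ∉ map (proj₁ ∘ f) es
    orig∉witnesses f es orig∈ with ∈-map⁻ (proj₁ ∘ f) orig∈
    ... | e , _ , eq = ¬InGadget-orig (subst (InGadget e) (sym eq) (proj₁ (proj₂ (f e))))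

    covered : List (Fin n)
    covered = filter (λ x → orig x ∈? S) (allFin n)

    uncoveredEdges : List Edge
    uncoveredEdges = filter uncovered? edges

    witnesses : List V
    witnesses = map orig covered ++ (map (proj₁ ∘ witness-src) edges ++ map (proj₁ ∘ witness-tgt) uncoveredEdges)

    witnesses-unique : Unique witnesses
    witnesses-unique = Unique.++⁺
      (Unique.map⁺ orig-injective (Unique.filter⁺ (λ x → orig x ∈? S) (Unique.allFin⁺ n)))
      (Unique.++⁺ (Unique.map⁺ (witness-injective witness-src) edges-unique)
                  (Unique.map⁺ (witness-injective witness-tgt) (Unique.filter⁺ uncovered? edges-unique))
                  src#tgt)
      orig#gadgets
      where
      src#tgt : Disjoint (map (proj₁ ∘ witness-src) edges) (map (proj₁ ∘ witness-tgt) uncoveredEdges)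
      src#tgt (v∈src , v∈tgt) with ∈-map⁻ (proj₁ ∘ witness-src) v∈src | ∈-map⁻ (proj₁ ∘ witness-tgt) v∈tgt
      ... | e , _ , refl | e' , e'∈ , eq
        with gadget-injective (proj₁ (proj₂ (witness-src e))) (proj₁ (proj₂ (witness-tgt e'))) eq
      ... | refl = witnesses-differ e (proj₂ (∈-filter⁻ uncovered? {xs = edges} e'∈)) eq

      orig#gadgets : Disjoint (map orig covered)
                              (map (proj₁ ∘ witness-src) edges ++ map (proj₁ ∘ witness-tgt) uncoveredEdges)
      orig#gadgets (v∈orig , v∈gadgets) with ∈-map⁻ orig v∈orig
      ... | _ , _ , refl with ∈-++⁻ (map (proj₁ ∘ witness-src) edges) v∈gadgets
      ...   | inj₁ v∈src = orig∉witnesses witness-src edges v∈src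
      ...   | inj₂ v∈tgt = orig∉witnesses witness-tgt uncoveredEdges v∈tgt

    witnesses-in-S : All (_∈ S) witnesses
    witnesses-in-S = All.++⁺
      (All.map⁺ {f = orig} (All.tabulate λ x∈ → proj₂ (∈-filter⁻ (λ x → orig x ∈? S) {xs = allFin n} x∈)))
      (All.++⁺ (All.map⁺ {f = proj₁ ∘ witness-src} (All.tabulate λ {e} (_ : e ∈ edges) → proj₂ (proj₂ (witness-src e))))
               (All.map⁺ {f = proj₁ ∘ witness-tgt} (All.tabulate λ {e} _ → proj₂ (proj₂ (witness-tgt e)))))

    length-witnesses : length witnesses ≡ length covered + (numEdges G + length uncoveredEdges)
    length-witnesses = trans (length-++ (map orig covered)) (cong₂ _+_ (length-map orig covered)
      (trans (length-++ (map (proj₁ ∘ witness-src) edges))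
             (cong₂ _+_ (trans (length-map _ edges) length-edges) (length-map _ uncoveredEdges))))

    cover : List (Fin n)
    cover = deduplicate _≟ᶠ_ (covered ++ map src uncoveredEdges)

    length-cover : length cover ≤ length covered + length uncoveredEdges
    length-cover = ≤-trans (length-deduplicate _≟ᶠ_ (covered ++ map src uncoveredEdges))
      (≤-reflexive (trans (length-++ covered) (cong (length covered +_) (length-map src uncoveredEdges))))

    cover-unique : Unique cover
    cover-unique = DecUnique.deduplicate-! _≟ᶠ_ (covered ++ map src uncoveredEdges)

    ∈cover-covered : ∀ {x} → orig x ∈ S → x ∈ cover
    ∈cover-covered {x} x∈S = ∈-deduplicate⁺ _≟ᶠ_ (∈-++⁺ˡ (∈-filter⁺ (λ x → orig x ∈? S) (∈-allFin x) x∈S))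

    src∈cover : ∀ {e} → e ∈ edges → Uncovered e → src e ∈ cover
    src∈cover e∈ unc = ∈-deduplicate⁺ _≟ᶠ_ (∈-++⁺ʳ covered (∈-map⁺ src (∈-filter⁺ uncovered? e∈ unc)))

    cover-isVertexCover : IsVertexCover G cover
    cover-isVertexCover x y h with orig x ∈? S | orig y ∈? S
    ... | yes x∈S | _       = inj₁ (∈cover-covered x∈S)
    ... | no _    | yes y∈S = inj₂ (∈cover-covered y∈S)
    ... | no x∉S  | no y∉S with <-cmp x y
    ...   | tri< l _ _   = inj₁ (src∈cover (edge∈edges h l) (x∉S , y∉S))
    ...   | tri≈ _ x≡y _ = ⊥-elim (adj⇒≢ h x≡y)
    ...   | tri> _ _ l   = inj₂ (src∈cover (edge∈edges (adj-flip h) l) (y∉S , x∉S))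

    τ+|E|≤|S| : ∀ t → (∀ C → Unique C → IsVertexCover G C → t ≤ length C) → t + numEdges G ≤ length S
    τ+|E|≤|S| t τ-minimal = begin
      t + numEdges G
        ≤⟨ +-monoˡ-≤ (numEdges G) (≤-trans (τ-minimal cover cover-unique cover-isVertexCover) length-cover) ⟩
      length covered + length uncoveredEdges + numEdges G
        ≡⟨ +-assoc (length covered) (length uncoveredEdges) (numEdges G) ⟩
      length covered + (length uncoveredEdges + numEdges G)
        ≡⟨ cong (length covered +_) (+-comm (length uncoveredEdges) (numEdges G)) ⟩
      length covered + (numEdges G + length uncoveredEdges)
        ≡⟨ length-witnesses ⟨
      length witnesses
        ≤⟨ Unique⇒length-≤ witnesses-unique (All.lookup witnesses-in-S) ⟩
      length S ∎
      where open ≤-Reasoning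

  wN≢mid : ∀ {c u m a b} .{h : adj a b ≡ true} → MidOf c u m → wN a b h ≢ m
  wN≢mid (mid< _) ()
  wN≢mid (mid> _) ()

  orig≢mid : ∀ {c u m a} → MidOf c u m → orig a ≢ m
  orig≢mid (mid< _) ()
  orig≢mid (mid> _) ()

  zN≢mid : ∀ {c u m a b} .{h : adj a b ≡ true} → MidOf c u m → zN a b h ≢ m
  zN≢mid (mid< _) ()
  zN≢mid (mid> _) ()

  wN≢tip : ∀ {c u z a b} .{h : adj a b ≡ true} → TipOf c u z → wN a b h ≢ z
  wN≢tip tip-near ()
  wN≢tip tip-far  ()

  orig≢tip : ∀ {c u z a} → TipOf c u z → orig a ≢ z
  orig≢tip tip-near ()
  orig≢tip tip-far  ()

  mid≢tip : ∀ {c u m c' u' z} → MidOf c u m → TipOf c' u' z → m ≢ z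
  mid≢tip (mid< _) tip-near ()
  mid≢tip (mid< _) tip-far  ()
  mid≢tip (mid> _) tip-near ()
  mid≢tip (mid> _) tip-far  ()

  mid≢mid : ∀ {c u u' m m'} → MidOf c u m → MidOf c u' m' → u ≢ u' → m ≢ m'
  mid≢mid mo mo' u≢u' refl = u≢u' (MidOf-injective mo mo')

  tip≢tip : ∀ {c u u' z z'} → TipOf c u z → TipOf c u' z' → u ≢ u' → z ≢ z'
  tip≢tip zo zo' u≢u' refl = u≢u' (TipOf-injective zo zo')

  wN≢wN-src : ∀ {a b a' b'} .{h : adj a b ≡ true} .{h' : adj a' b' ≡ true} →
              a ≢ a' → _≢_ {A = V} (wN a b h) (wN a' b' h')
  wN≢wN-src a≢a' refl = a≢a' refl

  wN≢wN-tgt : ∀ {a b b'} .{h : adj a b ≡ true} .{h' : adj a b' ≡ true} →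
              b ≢ b' → _≢_ {A = V} (wN a b h) (wN a b' h')
  wN≢wN-tgt b≢b' refl = b≢b' refl

  module UpperBound (cubic : Cubic G) (C : List (Fin n)) (C-unique : Unique C) (C-cover : IsVertexCover G C) where
    open DecMembership (_≟ᶠ_ {n}) using (_∈?_)

    tip : Edge → V
    tip (edge x y h l) with x ∈? C
    ... | yes _ = zN y x (adj-flip h)
    ... | no  _ = zN x y h

    S : List V
    S = map orig C ++ map tip edges

    tip-in-gadget : ∀ e → InGadget e (tip e)
    tip-in-gadget (edge x y h l) with x ∈? C
    ... | yes _ = gadget-z-tgt
    ... | no  _ = gadget-z-src

    S-unique : Unique S
    S-unique = Unique.++⁺ (Unique.map⁺ orig-injective C-unique)
      (Unique.map⁺ (λ {e} {e'} → gadget-injective (tip-in-gadget e) (tip-in-gadget e')) edges-unique)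
      orig#tips
      where
      orig#tips : Disjoint (map orig C) (map tip edges)
      orig#tips (v∈orig , v∈tips) with ∈-map⁻ orig v∈orig | ∈-map⁻ tip v∈tips
      ... | _ , _ , refl | e , _ , eq = ¬InGadget-orig (subst (InGadget e) (sym eq) (tip-in-gadget e))

    length-S : length S ≡ length C + numEdges G
    length-S = trans (length-++ (map orig C))
      (cong₂ _+_ (length-map orig C) (trans (length-map tip edges) length-edges))

    orig∈S : ∀ {x} → x ∈ C → orig x ∈ S
    orig∈S x∈C = ∈-++⁺ˡ (∈-map⁺ orig x∈C)

    tip∈S : ∀ {x y} (h : adj x y ≡ true) (l : x <ᶠ y) → tip (edge x y h l) ∈ S
    tip∈S h l = ∈-++⁺ʳ (map orig C) (∈-map⁺ tip (edge∈edges h l))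

    tip-spec : ∀ {x y} (h : adj x y ≡ true) .(l : x <ᶠ y) →
               (tip (edge x y h l) ≡ zN y x (adj-flip h) × x ∈ C) ⊎ (tip (edge x y h l) ≡ zN x y h × x ∉ C)
    tip-spec {x} h l with x ∈? C
    ... | yes x∈C = inj₁ (refl , x∈C)
    ... | no  x∉C = inj₂ (refl , x∉C)

    other-endpoint-covered : ∀ {x y} → adj x y ≡ true → x ∉ C → y ∈ C
    other-endpoint-covered {x} {y} h x∉C with C-cover x y h
    ... | inj₁ x∈C = ⊥-elim (x∉C x∈C)
    ... | inj₂ y∈C = y∈C

    covered-tip : ∀ c u (h : adj c u ≡ true) → (zN c u h ∈ S × u ∈ C) ⊎ (zN u c (adj-flip h) ∈ S × c ∈ C)
    covered-tip c u h with <-cmp c u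
    ... | tri≈ _ c≡u _ = ⊥-elim (adj⇒≢ h c≡u)
    ... | tri< l _ _ with tip-spec h l
    ...   | inj₁ (eq , c∈C) = inj₂ (subst (_∈ S) eq (tip∈S h l) , c∈C)
    ...   | inj₂ (eq , c∉C) = inj₁ (subst (_∈ S) eq (tip∈S h l) , other-endpoint-covered h c∉C)
    covered-tip c u h | tri> _ _ l with tip-spec (adj-flip h) l
    ...   | inj₁ (eq , u∈C) = inj₁ (subst (_∈ S) eq (tip∈S (adj-flip h) l) , u∈C)
    ...   | inj₂ (eq , u∉C) =
      inj₂ (subst (_∈ S) eq (tip∈S (adj-flip h) l) , other-endpoint-covered (adj-flip h) u∉C)

    tip-in-S : ∀ {c u} → adj c u ≡ true → Σ V λ z → TipOf c u z × z ∈ S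
    tip-in-S {c} {u} h with covered-tip c u h
    ... | inj₁ (z∈S , _) = _ , tip-near , z∈S
    ... | inj₂ (z∈S , _) = _ , tip-far  , z∈S

    PathFrom : V → List V → Set
    PathFrom = PathToSet E S

    tip-path : ∀ {c u m z} .{h : adj c u ≡ true} → MidOf c u m → TipOf c u z → z ∈ S →
               PathFrom (wN c u h) (m ∷ z ∷ [])
    tip-path mo zo z∈S = pathToSet-∷ (w-mid mo) (wN≢mid mo ∷ wN≢tip zo ∷ [])
      (pathToSet-edge (mid-tip mo zo) (mid≢tip mo zo) z∈S)

    branch : ∀ {c d u m z} .{h : adj c d ≡ true} .{h' : adj c u ≡ true} → u ≢ d →
             MidOf c u m → TipOf c u z → z ∈ S → PathFrom (wN c d h) (wN c u h' ∷ m ∷ z ∷ [])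
    branch {c} {d} {u} {h = h} {h'} u≢d mo zo z∈S =
      pathToSet-∷ (inj₁ (a-ww c d u h h' (≢-sym u≢d))) (wN≢wN-tgt (≢-sym u≢d) ∷ wN≢mid mo ∷ wN≢tip zo ∷ [])
        (tip-path mo zo z∈S)

    module _ {c d u₁ u₂ m m₁ m₂ z₁ z₂} (h : adj c d ≡ true) (h₁ : adj c u₁ ≡ true) (h₂ : adj c u₂ ≡ true)
             (u₁≢d : u₁ ≢ d) (u₂≢d : u₂ ≢ d) (u₁≢u₂ : u₁ ≢ u₂)
             (mo : MidOf c d m) (mo₁ : MidOf c u₁ m₁) (mo₂ : MidOf c u₂ m₂)
             (zo₁ : TipOf c u₁ z₁) (zo₂ : TipOf c u₂ z₂) (z₁∈S : z₁ ∈ S) (z₂∈S : z₂ ∈ S) where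

      private
        c≢d : c ≢ d
        c≢d = adj⇒≢ h

        u₁#u₂ : All (λ v → All (v ≢_) (wN c u₂ h₂ ∷ m₂ ∷ z₂ ∷ [])) (wN c u₁ h₁ ∷ m₁ ∷ z₁ ∷ [])
        u₁#u₂ = (wN≢wN-tgt u₁≢u₂ ∷ wN≢mid mo₂ ∷ wN≢tip zo₂ ∷ [])
              ∷ (≢-sym (wN≢mid mo₁) ∷ mid≢mid mo₁ mo₂ u₁≢u₂ ∷ mid≢tip mo₁ zo₂ ∷ [])
              ∷ (≢-sym (wN≢tip zo₁) ∷ ≢-sym (mid≢tip mo₂ zo₁) ∷ tip≢tip zo₁ zo₂ u₁≢u₂ ∷ []) ∷ []

        m#u : ∀ {u mᵤ zᵤ} .{hᵤ : adj c u ≡ true} → u ≢ d → MidOf c u mᵤ → TipOf c u zᵤ →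
              All (m ≢_) (wN c u hᵤ ∷ mᵤ ∷ zᵤ ∷ [])
        m#u u≢d moᵤ zoᵤ = ≢-sym (wN≢mid mo) ∷ mid≢mid mo moᵤ (≢-sym u≢d) ∷ mid≢tip mo zoᵤ ∷ []

      fan-wN-via-d : zN c d h ∈ S → d ∈ C → Fan E S (wN c d h) 4
      fan-wN-via-d z∈S d∈C = _ , refl , P₁ ∷ P₂ ∷ P₃ ∷ P₄ ∷ [] ,
          (All≢⇒Disjoint D₁₂ ∷ All≢⇒Disjoint D₁₃ ∷ All≢⇒Disjoint D₁₄ ∷ [])
        ∷ (All≢⇒Disjoint D₂₃ ∷ All≢⇒Disjoint D₂₄ ∷ []) ∷ (All≢⇒Disjoint D₃₄ ∷ []) ∷ [] ∷ []
        where
        P₁ : PathFrom (wN c d h) (zN c d h ∷ [])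
        P₁ = pathToSet-edge (inj₁ (a-wz c d h)) (λ ()) z∈S
        P₂ : PathFrom (wN c d h) (m ∷ wN d c (adj-flip h) ∷ orig d ∷ [])
        P₂ = pathToSet-∷ (w-mid mo) (wN≢mid mo ∷ wN≢wN-src c≢d ∷ (λ ()) ∷ [])
               (pathToSet-∷ (swap (w-mid (MidOf-sym mo))) (≢-sym (wN≢mid (MidOf-sym mo)) ∷ ≢-sym (orig≢mid mo) ∷ [])
                 (pathToSet-edge (inj₂ (a-xw d c (adj-flip h))) (λ ()) (orig∈S d∈C)))
        P₃ : PathFrom (wN c d h) (orig c ∷ wN c u₁ h₁ ∷ m₁ ∷ z₁ ∷ [])
        P₃ = pathToSet-∷ (inj₂ (a-xw c d h)) ((λ ()) ∷ wN≢wN-tgt (≢-sym u₁≢d) ∷ wN≢mid mo₁ ∷ wN≢tip zo₁ ∷ [])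
               (pathToSet-∷ (inj₁ (a-xw c u₁ h₁)) ((λ ()) ∷ orig≢mid mo₁ ∷ orig≢tip zo₁ ∷ [])
                 (tip-path mo₁ zo₁ z₁∈S))
        P₄ : PathFrom (wN c d h) (wN c u₂ h₂ ∷ m₂ ∷ z₂ ∷ [])
        P₄ = branch u₂≢d mo₂ zo₂ z₂∈S
        D₁₂ : All (λ v → All (v ≢_) (m ∷ wN d c (adj-flip h) ∷ orig d ∷ [])) (zN c d h ∷ [])
        D₁₂ = (zN≢mid mo ∷ (λ ()) ∷ (λ ()) ∷ []) ∷ []
        D₁₃ : All (λ v → All (v ≢_) (orig c ∷ wN c u₁ h₁ ∷ m₁ ∷ z₁ ∷ [])) (zN c d h ∷ [])
        D₁₃ = ((λ ()) ∷ (λ ()) ∷ zN≢mid mo₁ ∷ tip≢tip tip-near zo₁ (≢-sym u₁≢d) ∷ []) ∷ []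
        D₁₄ : All (λ v → All (v ≢_) (wN c u₂ h₂ ∷ m₂ ∷ z₂ ∷ [])) (zN c d h ∷ [])
        D₁₄ = ((λ ()) ∷ zN≢mid mo₂ ∷ tip≢tip tip-near zo₂ (≢-sym u₂≢d) ∷ []) ∷ []
        D₂₃ : All (λ v → All (v ≢_) (orig c ∷ wN c u₁ h₁ ∷ m₁ ∷ z₁ ∷ [])) (m ∷ wN d c (adj-flip h) ∷ orig d ∷ [])
        D₂₃ = (≢-sym (orig≢mid mo) ∷ m#u u₁≢d mo₁ zo₁)
            ∷ ((λ ()) ∷ wN≢wN-src (≢-sym c≢d) ∷ wN≢mid mo₁ ∷ wN≢tip zo₁ ∷ [])
            ∷ ((λ eq → c≢d (sym (orig-injective eq))) ∷ (λ ()) ∷ orig≢mid mo₁ ∷ orig≢tip zo₁ ∷ []) ∷ []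
        D₂₄ : All (λ v → All (v ≢_) (wN c u₂ h₂ ∷ m₂ ∷ z₂ ∷ [])) (m ∷ wN d c (adj-flip h) ∷ orig d ∷ [])
        D₂₄ = m#u u₂≢d mo₂ zo₂
            ∷ (wN≢wN-src (≢-sym c≢d) ∷ wN≢mid mo₂ ∷ wN≢tip zo₂ ∷ [])
            ∷ ((λ ()) ∷ orig≢mid mo₂ ∷ orig≢tip zo₂ ∷ []) ∷ []
        D₃₄ : All (λ v → All (v ≢_) (wN c u₂ h₂ ∷ m₂ ∷ z₂ ∷ [])) (orig c ∷ wN c u₁ h₁ ∷ m₁ ∷ z₁ ∷ [])
        D₃₄ = ((λ ()) ∷ orig≢mid mo₂ ∷ orig≢tip zo₂ ∷ []) ∷ u₁#u₂

      fan-wN-via-c : zN d c (adj-flip h) ∈ S → c ∈ C → Fan E S (wN c d h) 4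
      fan-wN-via-c z∈S c∈C = _ , refl , P₁ ∷ P₂ ∷ P₃ ∷ P₄ ∷ [] ,
          (All≢⇒Disjoint D₁₂ ∷ All≢⇒Disjoint D₁₃ ∷ All≢⇒Disjoint D₁₄ ∷ [])
        ∷ (All≢⇒Disjoint D₂₃ ∷ All≢⇒Disjoint D₂₄ ∷ []) ∷ (All≢⇒Disjoint u₁#u₂ ∷ []) ∷ [] ∷ []
        where
        P₁ : PathFrom (wN c d h) (m ∷ zN d c (adj-flip h) ∷ [])
        P₁ = pathToSet-∷ (w-mid mo) (wN≢mid mo ∷ (λ ()) ∷ [])
               (pathToSet-edge (mid-tip mo tip-far) (mid≢tip mo tip-far) z∈S)
        P₂ : PathFrom (wN c d h) (orig c ∷ [])
        P₂ = pathToSet-edge (inj₂ (a-xw c d h)) (λ ()) (orig∈S c∈C)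
        P₃ : PathFrom (wN c d h) (wN c u₁ h₁ ∷ m₁ ∷ z₁ ∷ [])
        P₃ = branch u₁≢d mo₁ zo₁ z₁∈S
        P₄ : PathFrom (wN c d h) (wN c u₂ h₂ ∷ m₂ ∷ z₂ ∷ [])
        P₄ = branch u₂≢d mo₂ zo₂ z₂∈S
        D₁₂ : All (λ v → All (v ≢_) (orig c ∷ [])) (m ∷ zN d c (adj-flip h) ∷ [])
        D₁₂ = (≢-sym (orig≢mid mo) ∷ []) ∷ ((λ ()) ∷ []) ∷ []
        D₁₃ : All (λ v → All (v ≢_) (wN c u₁ h₁ ∷ m₁ ∷ z₁ ∷ [])) (m ∷ zN d c (adj-flip h) ∷ [])
        D₁₃ = m#u u₁≢d mo₁ zo₁ ∷ ((λ ()) ∷ zN≢mid mo₁ ∷ tip≢tip tip-far zo₁ (≢-sym u₁≢d) ∷ []) ∷ []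
        D₁₄ : All (λ v → All (v ≢_) (wN c u₂ h₂ ∷ m₂ ∷ z₂ ∷ [])) (m ∷ zN d c (adj-flip h) ∷ [])
        D₁₄ = m#u u₂≢d mo₂ zo₂ ∷ ((λ ()) ∷ zN≢mid mo₂ ∷ tip≢tip tip-far zo₂ (≢-sym u₂≢d) ∷ []) ∷ []
        D₂₃ : All (λ v → All (v ≢_) (wN c u₁ h₁ ∷ m₁ ∷ z₁ ∷ [])) (orig c ∷ [])
        D₂₃ = ((λ ()) ∷ orig≢mid mo₁ ∷ orig≢tip zo₁ ∷ []) ∷ []
        D₂₄ : All (λ v → All (v ≢_) (wN c u₂ h₂ ∷ m₂ ∷ z₂ ∷ [])) (orig c ∷ [])
        D₂₄ = ((λ ()) ∷ orig≢mid mo₂ ∷ orig≢tip zo₂ ∷ []) ∷ []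

    fan-wN : ∀ c d (h : adj c d ≡ true) → Fan E S (wN c d h) 4
    fan-wN c d h with midOf h | other-neighbours cubic h
    ... | _ , mo | u₁ , u₂ , h₁ , h₂ , u₁≢d , u₂≢d , u₁≢u₂
      with midOf h₁ | midOf h₂ | tip-in-S h₁ | tip-in-S h₂ | covered-tip c d h
    ... | _ , mo₁ | _ , mo₂ | _ , zo₁ , z₁∈S | _ , zo₂ , z₂∈S | inj₁ (z∈S , d∈C) =
      fan-wN-via-d h h₁ h₂ u₁≢d u₂≢d u₁≢u₂ mo mo₁ mo₂ zo₁ zo₂ z₁∈S z₂∈S z∈S d∈C
    ... | _ , mo₁ | _ , mo₂ | _ , zo₁ , z₁∈S | _ , zo₂ , z₂∈S | inj₂ (z∈S , c∈C) =
      fan-wN-via-c h h₁ h₂ u₁≢d u₂≢d u₁≢u₂ mo mo₁ mo₂ zo₁ zo₂ z₁∈S z₂∈S z∈S c∈C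

    fan-mid : ∀ a b (h : adj a b ≡ true) {v} → MidOf a b v → zN a b h ∈ S → b ∈ C → Fan E S v 3
    fan-mid a b h {v} mo z∈S b∈C with other-neighbours cubic h
    ... | u₁ , _ , h₁ , _ , u₁≢b , _ with midOf h₁ | tip-in-S h₁
    ... | _ , mo₁ | _ , zo₁ , z₁∈S = _ , refl , P₁ ∷ P₂ ∷ P₃ ∷ [] ,
        (All≢⇒Disjoint D₁₂ ∷ All≢⇒Disjoint D₁₃ ∷ []) ∷ (All≢⇒Disjoint D₂₃ ∷ []) ∷ [] ∷ []
      where
      a≢b : a ≢ b
      a≢b = adj⇒≢ h
      P₁ : PathFrom v (zN a b h ∷ [])
      P₁ = pathToSet-edge (mid-tip mo tip-near) (mid≢tip mo tip-near) z∈S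
      P₂ : PathFrom v (wN b a (adj-flip h) ∷ orig b ∷ [])
      P₂ = pathToSet-∷ (swap (w-mid (MidOf-sym mo))) (≢-sym (wN≢mid (MidOf-sym mo)) ∷ ≢-sym (orig≢mid mo) ∷ [])
             (pathToSet-edge (inj₂ (a-xw b a (adj-flip h))) (λ ()) (orig∈S b∈C))
      P₃ : PathFrom v (wN a b h ∷ wN a u₁ h₁ ∷ _ ∷ _ ∷ [])
      P₃ = pathToSet-∷ (swap (w-mid mo))
             (≢-sym (wN≢mid mo) ∷ ≢-sym (wN≢mid mo) ∷ mid≢mid mo mo₁ (≢-sym u₁≢b) ∷ mid≢tip mo zo₁ ∷ [])
             (branch u₁≢b mo₁ zo₁ z₁∈S)
      D₁₂ : All (λ x → All (x ≢_) (wN b a (adj-flip h) ∷ orig b ∷ [])) (zN a b h ∷ [])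
      D₁₂ = ((λ ()) ∷ (λ ()) ∷ []) ∷ []
      D₁₃ : All (λ x → All (x ≢_) (wN a b h ∷ wN a u₁ h₁ ∷ _ ∷ _ ∷ [])) (zN a b h ∷ [])
      D₁₃ = ((λ ()) ∷ (λ ()) ∷ zN≢mid mo₁ ∷ tip≢tip tip-near zo₁ (≢-sym u₁≢b) ∷ []) ∷ []
      D₂₃ : All (λ x → All (x ≢_) (wN a b h ∷ wN a u₁ h₁ ∷ _ ∷ _ ∷ [])) (wN b a (adj-flip h) ∷ orig b ∷ [])
      D₂₃ = (wN≢wN-src (≢-sym a≢b) ∷ wN≢wN-src (≢-sym a≢b) ∷ wN≢mid mo₁ ∷ wN≢tip zo₁ ∷ [])
          ∷ ((λ ()) ∷ (λ ()) ∷ orig≢mid mo₁ ∷ orig≢tip zo₁ ∷ []) ∷ []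

    fan-wM : ∀ x y (h : adj x y ≡ true) .(l : x <ᶠ y) → Fan E S (wM x y h l) 3
    fan-wM x y h l with covered-tip x y h
    ... | inj₁ (z∈S , y∈C) = fan-mid x y h (mid< l) z∈S y∈C
    ... | inj₂ (z∈S , x∈C) = fan-mid y x (adj-flip h) (mid> l) z∈S x∈C

    S-isVCSet : IsVCSet E (r' G) S
    S-isVCSet (orig _)     _ = [] , refl , [] , []
    S-isVCSet (zN _ _ _)   _ = [] , refl , [] , []
    S-isVCSet (wN c d h)   _ = fan-wN c d (adj-recompute h)
    S-isVCSet (wM x y h l) _ = fan-wM x y (adj-recompute h) l

lemma1 : (G : SimpleGraph) → Cubic G → TwoConnected G → Planar G →
         ∀ (t : ℕ) → IsTau G t → IsKappa (E' G) (r' G) (t + numEdges G)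
lemma1 G cubic _ _ t ((C , C-unique , C-cover , |C|≡t) , τ-minimal) =
    (S , S-unique , S-isVCSet , trans length-S (cong (_+ numEdges G) |C|≡t))
  , λ S' _ S'-isVCSet → LowerBound.τ+|E|≤|S| cubic S' S'-isVCSet t τ-minimal
  where
  open Construction G
  open UpperBound cubic C C-unique C-cover
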